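{- For every $n\ge 4$ and every signature $\sigma$ on the complete graph $K_n$, the signed complete graph $K_n^\sigma=(K_n,\sigma)$ satisfies $2\le \dim(K_n^\sigma)\le n-1$.
   Context: A signed graph is $(G,\sigma)$ with $\sigma:E(G)\to\{+1,-1\}$. In a signed complete graph, the signed distance between distinct vertices $u,v$ is $d_\Sigma(u,v)=\sigma(uv)\in\{+1,-1\}$ (the sign of the edge $uv$), and $d_\Sigma(u,u)=0$. For an ordered vertex set $W=(w_1,\dots,w_k)$, $r(v|W)=(d_\Sigma(v,w_1),\dots,d_\Sigma(v,w_k))$; $W$ is resolving if distinct vertices have distinct representations; $\dim$ is the minimum cardinality of a resolving set. -}

module Defs where

open import Data.Nat using (ℕ; _≤_)
open import Data.Fin using (Fin)
open import Data.Fin.Properties using (_≟_)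
open import Data.Integer using (ℤ; +_; -_)
open import Data.Sign using (Sign) renaming (+ to pos; - to neg)
open import Data.List using (List; map; length)
open import Data.List.Relation.Unary.Unique.Propositional using (Unique)
open import Data.Product using (Σ; _×_)
open import Relation.Nullary using (yes; no)
open import Relation.Binary.PropositionalEquality using (_≡_)

-- A signature on the complete graph K_n: a sign on each unordered pair of
-- distinct vertices, encoded as a symmetric function on ordered pairs
-- (the diagonal values are irrelevant).
Signature : ℕ → Set
Signature n = Fin n → Fin n → Sign

SymmetricSig : ∀ {n} → Signature n → Set
SymmetricSig {n} σ = ∀ (u v : Fin n) → σ u v ≡ σ v u

signToℤ : Sign → ℤ
signToℤ pos = + 1
signToℤ neg = - (+ 1)

dΣ : ∀ {n} → Signature n → Fin n → Fin n → ℤ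
dΣ σ u v with u ≟ v
... | yes _ = + 0
... | no  _ = signToℤ (σ u v)

rep : ∀ {n} → Signature n → Fin n → List (Fin n) → List ℤ
rep σ v W = map (dΣ σ v) W

Resolving : ∀ {n} → Signature n → List (Fin n) → Set
Resolving {n} σ W = ∀ (u v : Fin n) → rep σ u W ≡ rep σ v W → u ≡ v

IsDim : ∀ {n} → Signature n → ℕ → Set
IsDim {n} σ k =
  Σ (List (Fin n)) (λ W → Unique W × Resolving σ W × length W ≡ k)
  × (∀ (W : List (Fin n)) → Unique W → Resolving σ W → k ≤ length W)

{-# OPTIONS --safe #-}
module Submission where

-- Lower bound: a resolving list W separates the n vertices by their
-- representations, and each coordinate of a representation takes one of the
-- three values 0, 1, -1. So the empty list resolves at most one vertex and a
-- single landmark at most three, and for n ≥ 4 a resolving set has at least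
-- two elements. Upper bound: a landmark is the only vertex at distance 0 from
-- itself, so it is separated from every other vertex; hence the list of all
-- vertices but one is resolving, and it has n - 1 elements.

open import Defs
open import Data.Nat using (ℕ; _≤_; _∸_; suc; s≤s; z≤n)
open import Data.Nat.Properties using (≮⇒≥; ≤-trans)
open import Data.Product using (Σ; _×_; _,_; proj₁; proj₂)
open import Data.Fin using (Fin; zero; suc)
open import Data.Fin.Properties using (_≟_; pigeonhole; <-irrefl; suc-injective)
open import Data.Integer using (ℤ; +_; -_)
open import Data.Sign using (Sign) renaming (+ to pos; - to neg)
open import Data.List using (List; []; _∷_; length; tabulate)
open import Data.List.Properties using (∷-injectiveˡ; ∷-injectiveʳ; length-tabulate)
open import Data.List.Membership.Propositional using (_∈_)
open import Data.List.Membership.Propositional.Properties using (∈-tabulate⁺)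
open import Data.List.Relation.Unary.Any using (here; there)
open import Data.List.Relation.Unary.Unique.Propositional.Properties using (tabulate⁺)
open import Relation.Nullary using (yes; no; contradiction)
open import Relation.Nullary.Decidable using (decidable-stable)
open import Relation.Binary.PropositionalEquality 
  using (_≡_; _≢_; refl; sym; trans; cong; subst; module ≡-Reasoning)

private
  variable
    n : ℕ

dΣ-self : (σ : Signature n) (u : Fin n) → dΣ σ u u ≡ + 0
dΣ-self σ u with u ≟ u
... | yes _ = refl
... | no u≢u = contradiction refl u≢u

dΣ-≢0 : (σ : Signature n) {u v : Fin n} → u ≢ v → dΣ σ u v ≢ + 0
dΣ-≢0 σ {u} {v} u≢v with u ≟ v
... | yes u≡v = contradiction u≡v u≢v
... | no _    with σ u v
...   | pos = λ ()
...   | neg = λ ()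

ternary : Fin 3 → ℤ
ternary zero             = + 0
ternary (suc zero)       = + 1
ternary (suc (suc zero)) = - (+ 1)

dΣ-ternary : (σ : Signature n) (u v : Fin n) → Σ (Fin 3) λ t → ternary t ≡ dΣ σ u v
dΣ-ternary σ u v with u ≟ v
... | yes _ = zero , refl
... | no _  with σ u v
...   | pos = suc zero , refl
...   | neg = suc (suc zero) , refl

landmark-separates : (σ : Signature n) {w v : Fin n} → dΣ σ w w ≡ dΣ σ v w → w ≡ v
landmark-separates σ {w} {v} eq =
  sym (decidable-stable (v ≟ w) λ v≢w → dΣ-≢0 σ v≢w (trans (sym eq) (dΣ-self σ w)))

rep-injective-at-landmark : (σ : Signature n) {u v : Fin n} (W : List (Fin n)) →
  u ∈ W → rep σ u W ≡ rep σ v W → u ≡ v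
rep-injective-at-landmark σ (_ ∷ _) (here refl) eq = landmark-separates σ (∷-injectiveˡ eq)
rep-injective-at-landmark σ (_ ∷ W) (there u∈W) eq =
  rep-injective-at-landmark σ W u∈W (∷-injectiveʳ eq)

resolving-allBut : (σ : Signature n) (x : Fin n) (W : List (Fin n)) →
  (∀ u → u ≢ x → u ∈ W) → Resolving σ W
resolving-allBut σ x W covers u v eq with u ≟ x | v ≟ x
... | yes refl | yes refl = refl
... | no u≢x   | _        = rep-injective-at-landmark σ W (covers u u≢x) eq
... | _        | no v≢x   = sym (rep-injective-at-landmark σ W (covers v v≢x) (sym eq))

allButZero : ∀ m → List (Fin (suc m))
allButZero m = tabulate suc

resolving-allButZero : ∀ {m} (σ : Signature (suc m)) → Resolving σ (allButZero m)
resolving-allButZero σ = resolving-allBut σ zero _ covers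
  where
  covers : ∀ u → u ≢ zero → u ∈ tabulate suc
  covers zero    u≢0 = contradiction refl u≢0
  covers (suc i) _   = ∈-tabulate⁺ i

resolving⇒≤ : ∀ {m} (σ : Signature n) (W : List (Fin n)) (f : Fin n → Fin m) →
  (∀ u v → f u ≡ f v → rep σ u W ≡ rep σ v W) → Resolving σ W → n ≤ m
resolving⇒≤ σ W f determines res = ≮⇒≥ λ m<n →
  let i , j , i<j , fi≡fj = pigeonhole m<n f
  in  <-irrefl (res i j (determines i j fi≡fj)) i<j

resolving-[]⇒≤1 : (σ : Signature n) → Resolving σ [] → n ≤ 1
resolving-[]⇒≤1 σ = resolving⇒≤ σ [] (λ _ → zero) λ _ _ _ → refl

resolving-[w]⇒≤3 : (σ : Signature n) (w : Fin n) → Resolving σ (w ∷ []) → n ≤ 3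
resolving-[w]⇒≤3 σ w = resolving⇒≤ σ (w ∷ []) code determines
  where
  code : Fin _ → Fin 3
  code u = proj₁ (dΣ-ternary σ u w)
  determines : ∀ u v → code u ≡ code v → rep σ u (w ∷ []) ≡ rep σ v (w ∷ [])
  determines u v eq = cong (_∷ []) (begin
    dΣ σ u w              ≡⟨ sym (proj₂ (dΣ-ternary σ u w)) ⟩
    ternary (code u)      ≡⟨ cong ternary eq ⟩
    ternary (code v)      ≡⟨ proj₂ (dΣ-ternary σ v w) ⟩
    dΣ σ v w              ∎)
    where open ≡-Reasoning

resolving⇒2≤length : 4 ≤ n → (σ : Signature n) (W : List (Fin n)) →
  Resolving σ W → 2 ≤ length W
resolving⇒2≤length 4≤n σ [] res =
  contradiction (≤-trans 4≤n (resolving-[]⇒≤1 σ res)) λ { (s≤s ()) }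
resolving⇒2≤length 4≤n σ (w ∷ []) res =
  contradiction (≤-trans 4≤n (resolving-[w]⇒≤3 σ w res)) λ { (s≤s (s≤s (s≤s ()))) }
resolving⇒2≤length _ _ (_ ∷ _ ∷ _) _ = s≤s (s≤s z≤n)

theorem2p7 : ∀ (n : ℕ) → 4 ≤ n → (σ : Signature n) → SymmetricSig σ →
    ∀ (k : ℕ) → IsDim σ k → (2 ≤ k) × (k ≤ n ∸ 1)
theorem2p7 (suc m) 4≤n σ _ _ ((W , _ , res , refl) , minimal) =
  resolving⇒2≤length 4≤n σ W res ,
  subst (length W ≤_) (length-tabulate suc)
    (minimal (allButZero m) (tabulate⁺ suc-injective) (resolving-allButZero σ))
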